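{- Neither $\mathbf{ACT}_\omega$ nor the multiplicative-additive Lambek calculus $\mathbf{MALC}$ is strongly complete with respect to regular SCL-models. That is, for each of these two calculi there exist a (finite) set $\mathcal H$ of sequents and a sequent $\Pi\to C$ such that $\Pi\to C$ is true in every regular SCL-model in which all sequents of $\mathcal H$ are true, yet $\Pi\to C$ is not derivable from $\mathcal H$ in that calculus.
   Context: $\mathbf{MALC}$: formulae built from countably many variables and constants $\top,\bot,\mathbf 1$ with $\backslash,/,\cdot,\wedge,\vee$; sequents $A_1,\dots,A_n\to B$, $n\ge0$; rules: $A\to A$; $\Gamma,\bot,\Delta\to C$; $\Pi\to\top$; $\to\mathbf 1$; from $\Gamma,\Delta\to C$ infer $\Gamma,\mathbf 1,\Delta\to C$; from $\Gamma,A,B,\Delta\to C$ infer $\Gamma,A\cdot B,\Delta\to C$; from $\Gamma\to A$, $\Delta\to B$ infer $\Gamma,\Delta\to A\cdot B$; from $\Pi\to A$ and $\Gamma,B,\Delta\to C$ infer $\Gamma,\Pi,A\backslash B,\Delta\to C$ and $\Gamma,B/A,\Pi,\Delta\to C$; from $A,\Pi\to B$ infer $\Pi\to A\backslash B$; from $\Pi,A\to B$ infer $\Pi\to B/A$; from $\Gamma,A,\Delta\to C$ (or $\Gamma,B,\Delta\to C$) infer $\Gamma,A\wedge B,\Delta\to C$; from $\Pi\to A$, $\Pi\to B$ infer $\Pi\to A\wedge B$; from $\Gamma,A,\Delta\to C$ and $\Gamma,B,\Delta\to C$ infer $\Gamma,A\vee B,\Delta\to C$; from $\Pi\to A$ (or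 $\Pi\to B$) infer $\Pi\to A\vee B$; Cut: from $\Pi\to A$ and $\Gamma,A,\Delta\to C$ infer $\Gamma,\Pi,\Delta\to C$. $\mathbf{ACT}_\omega$ adds Kleene star with: from $\Gamma,A^n,\Delta\to C$ for all $n\ge0$ infer $\Gamma,A^*,\Delta\to C$; for $n\ge0$ from $\Pi_1\to A,\dots,\Pi_n\to A$ infer $\Pi_1,\dots,\Pi_n\to A^*$ (derivations infinite but well-founded). Derivability from $\mathcal H$: sequents of $\mathcal H$ used as extra axioms. SCL-models: alphabet $\Sigma$, $L\subseteq\Sigma^*$; $M^{\rhd}=\{(x,y)\in\Sigma^*\times\Sigma^*\mid\forall w\in M\;xwy\in L\}$, $C^{\lhd}=\{v\in\Sigma^*\mid\forall(x,y)\in C\;xvy\in L\}$; $\mathcal B(L)=\{M\subseteq\Sigma^*\mid M=M^{\rhd\lhd}\}$; interpretation $\alpha$ of variables in $\mathcal B(L)$ extended by $\cdot\mapsto (M_1M_2)^{\rhd\lhd}$, $\backslash,/$ as quotients $\{u\mid\forall v\in M_1\;vu\in M_2\}$, $\{u\mid\forall v\in M_1\;uv\in M_2\}$, $\wedge\mapsto\cap$, $\vee\mapsto(M_1\cup M_2)^{\rhd\lhd}$, $^*\mapsto(M^*)^{\rhd\lhd}$, $\top\mapsto\Sigma^*$, $\bot\mapsto\varnothing^{\rhd\lhd}$, $\mathbf 1\mapsto\{\varepsilon\}^{\rhd\lhd}$. $A_1,\dots,A_n\to B$ ($n\ge1$) is true if $(\alpha(A_1)\cdots\alpha(A_n))^{\rhd\lhd}\subseteq\alpha(B)$;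 $\to B$ is true if $\varepsilon\in\alpha(B)$. An SCL-model is regular if $L$ is a regular language. -}

module Defs where

open import Data.Bool using (Bool; true; false)
open import Data.Nat using (ℕ; zero; suc)
open import Data.Fin using (Fin)
open import Data.List using (List; []; _∷_; _++_; [_]; concat; replicate)
open import Data.List.Relation.Unary.All using (All)
open import Data.List.Membership.Propositional using (_∈_)
open import Data.Product using (Σ; Σ-syntax; _×_; _,_; ∃-syntax)
open import Data.Sum using (_⊎_)
open import Data.Vec.Functional using (Vector; toList)
open import Relation.Binary.PropositionalEquality using (_≡_)

-- Syntax.  Fm false = MALC formulae; Fm true = ACT_ω formulae (with *).

infixr 30 _·_
infixr 25 _∧_ _∨_

data Fm : Bool → Set where
  var  : ∀ {b} → ℕ → Fm b
  ⊤ ⊥ 𝟏 : ∀ {b} → Fm b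
  _＼_ _／_ _·_ _∧_ _∨_ : ∀ {b} → Fm b → Fm b → Fm b
  _⋆    : Fm true → Fm true

Seq : Bool → Set
Seq b = List (Fm b) × Fm b

infix 4 _⇒_
_⇒_ : ∀ {b} → List (Fm b) → Fm b → Seq b
Π ⇒ C = Π , C

data Der : (b : Bool) → List (Seq b) → Seq b → Set where
  hyp  : ∀ {b H s} → s ∈ H → Der b H s
  ax   : ∀ {b H} {A : Fm b} → Der b H ([ A ] ⇒ A)
  ⊥L   : ∀ {b H} {Γ Δ} {C : Fm b} → Der b H (Γ ++ ⊥ ∷ Δ ⇒ C)
  ⊤R   : ∀ {b H} {Π} → Der b H (Π ⇒ ⊤)
  𝟏R   : ∀ {b H} → Der b H ([] ⇒ 𝟏)
  𝟏L   : ∀ {b H} {Γ Δ} {C : Fm b} → Der b H (Γ ++ Δ ⇒ C) → Der b H (Γ ++ 𝟏 ∷ Δ ⇒ C)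
  ·L   : ∀ {b H} {Γ Δ} {A B C : Fm b} →
         Der b H (Γ ++ A ∷ B ∷ Δ ⇒ C) → Der b H (Γ ++ (A · B) ∷ Δ ⇒ C)
  ·R   : ∀ {b H} {Γ Δ} {A B : Fm b} →
         Der b H (Γ ⇒ A) → Der b H (Δ ⇒ B) → Der b H (Γ ++ Δ ⇒ A · B)
  ＼L  : ∀ {b H} {Γ Π Δ} {A B C : Fm b} →
         Der b H (Π ⇒ A) → Der b H (Γ ++ B ∷ Δ ⇒ C) →
         Der b H (Γ ++ Π ++ (A ＼ B) ∷ Δ ⇒ C)
  ／L  : ∀ {b H} {Γ Π Δ} {A B C : Fm b} →
         Der b H (Π ⇒ A) → Der b H (Γ ++ B ∷ Δ ⇒ C) →
         Der b H (Γ ++ (B ／ A) ∷ Π ++ Δ ⇒ C)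
  ＼R  : ∀ {b H} {Π} {A B : Fm b} → Der b H (A ∷ Π ⇒ B) → Der b H (Π ⇒ A ＼ B)
  ／R  : ∀ {b H} {Π} {A B : Fm b} → Der b H (Π ++ [ A ] ⇒ B) → Der b H (Π ⇒ B ／ A)
  ∧L₁  : ∀ {b H} {Γ Δ} {A B C : Fm b} →
         Der b H (Γ ++ A ∷ Δ ⇒ C) → Der b H (Γ ++ (A ∧ B) ∷ Δ ⇒ C)
  ∧L₂  : ∀ {b H} {Γ Δ} {A B C : Fm b} →
         Der b H (Γ ++ B ∷ Δ ⇒ C) → Der b H (Γ ++ (A ∧ B) ∷ Δ ⇒ C)
  ∧R   : ∀ {b H} {Π} {A B : Fm b} →
         Der b H (Π ⇒ A) → Der b H (Π ⇒ B) → Der b H (Π ⇒ A ∧ B)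
  ∨L   : ∀ {b H} {Γ Δ} {A B C : Fm b} →
         Der b H (Γ ++ A ∷ Δ ⇒ C) → Der b H (Γ ++ B ∷ Δ ⇒ C) →
         Der b H (Γ ++ (A ∨ B) ∷ Δ ⇒ C)
  ∨R₁  : ∀ {b H} {Π} {A B : Fm b} → Der b H (Π ⇒ A) → Der b H (Π ⇒ A ∨ B)
  ∨R₂  : ∀ {b H} {Π} {A B : Fm b} → Der b H (Π ⇒ B) → Der b H (Π ⇒ A ∨ B)
  cut  : ∀ {b H} {Γ Π Δ} {A C : Fm b} →
         Der b H (Π ⇒ A) → Der b H (Γ ++ A ∷ Δ ⇒ C) → Der b H (Γ ++ Π ++ Δ ⇒ C)
  ⋆L   : ∀ {H} {Γ Δ} {A C : Fm true} →
         ((n : ℕ) → Der true H (Γ ++ replicate n A ++ Δ ⇒ C)) →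
         Der true H (Γ ++ (A ⋆) ∷ Δ ⇒ C)
  ⋆R   : ∀ {H} {A : Fm true} (n : ℕ) (Πs : Vector (List (Fm true)) n) →
         ((i : Fin n) → Der true H (Πs i ⇒ A)) →
         Der true H (concat (toList Πs) ⇒ A ⋆)

record DFA (k : ℕ) : Set where
  field
    states : ℕ
    start  : Fin states
    δ      : Fin states → Fin k → Fin states
    accept : Fin states → Bool

  run : Fin states → List (Fin k) → Fin states
  run q []       = q
  run q (a ∷ w)  = run (δ q a) w

  Lang : List (Fin k) → Set
  Lang w = accept (run start w) ≡ true

-- SCL-models (syntactic concept lattices) over a language L ⊆ Σ*.

module SCL {Σ : Set} (L : List Σ → Set) where

  Word = List Σ
  Lg   = Word → Set

  _⊆_ : Lg → Lg → Set
  M ⊆ N = ∀ w → M w → N w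

  rt : Lg → Word → Word → Set
  rt M x y = ∀ w → M w → L (x ++ w ++ y)

  lt : (Word → Word → Set) → Lg
  lt C v = ∀ x y → C x y → L (x ++ v ++ y)

  cl : Lg → Lg
  cl M = lt (rt M)

  Closed : Lg → Set
  Closed M = (M ⊆ cl M) × (cl M ⊆ M)

  _⊗_ : Lg → Lg → Lg
  (M ⊗ N) w = Σ[ u ∈ Word ] Σ[ v ∈ Word ] (w ≡ u ++ v) × M u × N v

  _∪_ : Lg → Lg → Lg
  (M ∪ N) w = M w ⊎ N w

  _∩_ : Lg → Lg → Lg
  (M ∩ N) w = M w × N w

  star : Lg → Lg
  star M w = Σ[ ws ∈ List Word ] All M ws × (w ≡ concat ws)

  ⟦_⟧ : ∀ {b} → Fm b → (ℕ → Lg) → Lg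
  ⟦ var i ⟧ α   = α i
  ⟦ ⊤ ⟧ α w     = Data.Unit.⊤ where import Data.Unit
  ⟦ ⊥ ⟧ α       = cl (λ _ → Data.Empty.⊥) where import Data.Empty
  ⟦ 𝟏 ⟧ α       = cl (λ w → w ≡ [])
  ⟦ A ＼ B ⟧ α u = ∀ v → ⟦ A ⟧ α v → ⟦ B ⟧ α (v ++ u)
  ⟦ B ／ A ⟧ α u = ∀ v → ⟦ A ⟧ α v → ⟦ B ⟧ α (u ++ v)
  ⟦ A · B ⟧ α   = cl (⟦ A ⟧ α ⊗ ⟦ B ⟧ α)
  ⟦ A ∧ B ⟧ α   = ⟦ A ⟧ α ∩ ⟦ B ⟧ α
  ⟦ A ∨ B ⟧ α   = cl (⟦ A ⟧ α ∪ ⟦ B ⟧ α)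
  ⟦ A ⋆ ⟧ α     = cl (star (⟦ A ⟧ α))

  prod : ∀ {b} → Fm b → List (Fm b) → (ℕ → Lg) → Lg
  prod A []       α = ⟦ A ⟧ α
  prod A (B ∷ Γ)  α = ⟦ A ⟧ α ⊗ prod B Γ α

  True : ∀ {b} → (ℕ → Lg) → Seq b → Set
  True α ([] , B)     = ⟦ B ⟧ α []
  True α (A ∷ Γ , B)  = cl (prod A Γ α) ⊆ ⟦ B ⟧ α

record RegModel : Set₁ where
  field
    k     : ℕ
    dfa   : DFA k
  open DFA dfa using (Lang) public
  open SCL Lang using (Lg; Closed) public
  field
    α      : ℕ → Lg
    closed : ∀ i → Closed (α i)

TrueIn : ∀ {b} → RegModel → Seq b → Set
TrueIn M s = SCL.True (RegModel.Lang M) (RegModel.α M) s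

NotStronglyComplete : Bool → Set₁
NotStronglyComplete b =
  Σ[ H ∈ List (Seq b) ] Σ[ s ∈ Seq b ]
    (((M : RegModel) → (∀ h → h ∈ H → TrueIn M h) → TrueIn M s)
     × (Der b H s → Data.Empty.⊥))
  where import Data.Empty

-- Take 𝓗 = {→ z ; x, z, y → z ; x, z → w ; x, w → w ; z ∧ w → ⊥ ; → y · x} and the goal → ⊥.
-- The powerset of the group ℤ with x = {1}, y = {−1}, z = {0}, w = {1, 2, …} validates 𝓗
-- but not → ⊥, so by soundness the goal is not derivable, even in ACT_ω.
-- In a regular SCL-model let n be the number of states of a DFA for L. From → y · x we get
-- 1 ≤ yⁿxⁿyⁿxⁿ, and the first two hypotheses give xⁿyⁿ ≤ z. By pigeonhole, in any context the
-- DFA revisits a state while reading the n factors from x, so the context cannot distinguish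
-- xⁿyⁿ from some xᵐyⁿ with m > n; as xᵐyⁿ ≤ w by the third and fourth hypotheses and α(w) is
-- closed, xⁿyⁿ ≤ w. Hence 1 ≤ yⁿ (z ∧ w) xⁿ ≤ ⊥, which is the goal.
module Submission where

open import Defs
open import Algebra.Core using (Op₂)
open import Algebra.Structures using (IsMonoid)
open import Data.Bool using (Bool; true; false; if_then_else_)
open import Data.Empty using () renaming (⊥ to Empty)
open import Data.Fin as Fin using (Fin; toℕ)
open import Data.Fin.Properties using (pigeonhole; toℕ<n)
open import Data.Integer using (ℤ; +[1+_]; 0ℤ; 1ℤ; -1ℤ)
import Data.Integer.Properties as ℤ
open import Data.List using (List; []; _∷_; _++_; [_]; concat; replicate; length; take; drop)
open import Data.List.Properties
  using (++-assoc; ++-monoid; concat-++; length-++; length-take; length-drop; take++drop≡id)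
open import Data.List.Membership.Propositional using (_∈_)
open import Data.List.Relation.Unary.All using (All; []; _∷_; lookup)
open import Data.List.Relation.Unary.All.Properties using (++⁺; take⁺; drop⁺)
open import Data.List.Relation.Unary.Any using (here; there)
open import Data.Nat using (ℕ; zero; suc; _+_; _∸_; _⊓_; _≤_; _<_; s≤s)
open import Data.Nat.Properties
  using (≤-trans; ≤-<-trans; <-≤-trans; <⇒≤; ≤-reflexive; n<1+n; m<1+n⇒m≤n; m≤n⇒m<n∨m≡n;
         m≤n⇒m⊓n≡m; m+[n∸m]≡n; +-monoˡ-<; suc-injective; module ≤-Reasoning)
open import Data.Product using (Σ-syntax; _×_; _,_; proj₁; proj₂)
open import Data.Sum using (inj₁; inj₂)
open import Data.Vec.Functional using (Vector; toList)
open import Data.Unit using (tt) renaming (⊤ to Unit)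
open import Level using (0ℓ)
open import Relation.Binary.PropositionalEquality
  using (_≡_; refl; sym; trans; cong; cong₂; subst; module ≡-Reasoning)
open import Relation.Nullary using (¬_)
open import Relation.Unary using (Pred; U; ∅; ｛_｝; _∪_; ⋃) renaming (_⊆_ to _⊆ᵘ_)
open import Tactic.MonoidSolver using (solve)

module PowersetModel {M : Set} {_∙_ : Op₂ M} {ε : M} (isMonoid : IsMonoid _≡_ _∙_ ε)
                     (ρ : ℕ → Pred M 0ℓ) where
  open IsMonoid isMonoid using (assoc; identityˡ; identityʳ)

  _⊗_ : Pred M 0ℓ → Pred M 0ℓ → Pred M 0ℓ
  (P ⊗ Q) w = Σ[ u ∈ M ] Σ[ v ∈ M ] w ≡ u ∙ v × P u × Q v

  _^_ : Pred M 0ℓ → ℕ → Pred M 0ℓ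
  P ^ zero  = ｛ ε ｝
  P ^ suc n = P ⊗ (P ^ n)

  ⟦_⟧ : ∀ {b} → Fm b → Pred M 0ℓ
  ⟦ var i ⟧       = ρ i
  ⟦ ⊤ ⟧           = U
  ⟦ ⊥ ⟧           = ∅
  ⟦ 𝟏 ⟧           = ｛ ε ｝
  ⟦ A ＼ B ⟧ u    = ∀ v → ⟦ A ⟧ v → ⟦ B ⟧ (v ∙ u)
  ⟦ B ／ A ⟧ u    = ∀ v → ⟦ A ⟧ v → ⟦ B ⟧ (u ∙ v)
  ⟦ A · B ⟧       = ⟦ A ⟧ ⊗ ⟦ B ⟧
  ⟦ A ∧ B ⟧ w     = ⟦ A ⟧ w × ⟦ B ⟧ w
  ⟦ A ∨ B ⟧       = ⟦ A ⟧ ∪ ⟦ B ⟧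
  ⟦ A ⋆ ⟧         = ⋃ ℕ (⟦ A ⟧ ^_)

  ⟪_⟫ : ∀ {b} → List (Fm b) → Pred M 0ℓ
  ⟪ [] ⟫    = ｛ ε ｝
  ⟪ A ∷ Γ ⟫ = ⟦ A ⟧ ⊗ ⟪ Γ ⟫

  Holds : ∀ {b} → Seq b → Set
  Holds (Γ , C) = ⟪ Γ ⟫ ⊆ᵘ ⟦ C ⟧

  ⟪++⟫⁻ : ∀ {b} (Γ Δ : List (Fm b)) → ⟪ Γ ++ Δ ⟫ ⊆ᵘ ⟪ Γ ⟫ ⊗ ⟪ Δ ⟫
  ⟪++⟫⁻ []      Δ {w} s = ε , w , sym (identityˡ w) , refl , s
  ⟪++⟫⁻ (A ∷ Γ) Δ (a , _ , refl , α , s) with ⟪++⟫⁻ Γ Δ s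
  ... | u , v , refl , γ , δ = a ∙ u , v , sym (assoc a u v) , (a , u , refl , α , γ) , δ

  ⟪++⟫⁺ : ∀ {b} (Γ Δ : List (Fm b)) → ⟪ Γ ⟫ ⊗ ⟪ Δ ⟫ ⊆ᵘ ⟪ Γ ++ Δ ⟫
  ⟪++⟫⁺ []      Δ (_ , v , refl , refl , δ) = subst ⟪ Δ ⟫ (sym (identityˡ v)) δ
  ⟪++⟫⁺ (A ∷ Γ) Δ (_ , v , refl , (a , u , refl , α , γ) , δ) =
    a , u ∙ v , assoc a u v , α , ⟪++⟫⁺ Γ Δ (u , v , refl , γ , δ)

  ⟪[_]⟫⁻ : ∀ {b} (A : Fm b) → ⟪ [ A ] ⟫ ⊆ᵘ ⟦ A ⟧
  ⟪[ A ]⟫⁻ (u , _ , refl , α , refl) = subst ⟦ A ⟧ (sym (identityʳ u)) α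

  ⟪[_]⟫⁺ : ∀ {b} (A : Fm b) → ⟦ A ⟧ ⊆ᵘ ⟪ [ A ] ⟫
  ⟪[ A ]⟫⁺ {w} α = w , ε , sym (identityʳ w) , α , refl

  ⟪replicate⟫ : ∀ {b} (A : Fm b) n → ⟦ A ⟧ ^ n ⊆ᵘ ⟪ replicate n A ⟫
  ⟪replicate⟫ A zero    e                     = e
  ⟪replicate⟫ A (suc n) (u , v , e , α , αs) = u , v , e , α , ⟪replicate⟫ A n αs

  plug-⋃ : ∀ {b} (Γ Δ : List (Fm b)) {Φ} {I : Set} {Ψ : I → List (Fm b)} →
           ⟪ Φ ⟫ ⊆ᵘ ⋃ I (λ i → ⟪ Ψ i ⟫) →
           ⟪ Γ ++ Φ ++ Δ ⟫ ⊆ᵘ ⋃ I (λ i → ⟪ Γ ++ Ψ i ++ Δ ⟫)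
  plug-⋃ Γ Δ {Φ} {Ψ = Ψ} h s with ⟪++⟫⁻ Γ (Φ ++ Δ) s
  ... | g , _ , refl , γ , s′ with ⟪++⟫⁻ Φ Δ s′
  ... | f , d , refl , φ , δ with h φ
  ... | i , ψ = i , ⟪++⟫⁺ Γ (Ψ i ++ Δ) (g , _ , refl , γ , ⟪++⟫⁺ (Ψ i) Δ (f , d , refl , ψ , δ))

  plug : ∀ {b} (Γ Δ : List (Fm b)) {Φ Ψ} → ⟪ Φ ⟫ ⊆ᵘ ⟪ Ψ ⟫ → ⟪ Γ ++ Φ ++ Δ ⟫ ⊆ᵘ ⟪ Γ ++ Ψ ++ Δ ⟫
  plug Γ Δ h s = proj₂ (plug-⋃ Γ Δ {I = Unit} (λ φ → tt , h φ) s)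

  sound : ∀ {b H} {s : Seq b} → All Holds H → Der b H s → Holds s
  sound hs (hyp m)  = lookup hs m
  sound hs (ax {A = A}) = ⟪[ A ]⟫⁻
  sound hs (⊥L {Γ = Γ} {Δ}) s with plug-⋃ Γ Δ {I = Empty} {Ψ = λ ()} (λ { (_ , _ , _ , () , _) }) s
  ... | () , _
  sound hs ⊤R _  = tt
  sound hs 𝟏R e  = e
  sound {b} hs (𝟏L {Γ = Γ} {Δ} D) s = sound hs D (plug Γ Δ {Ψ = []} ⟪[ 𝟏 {b} ]⟫⁻ s)
  sound hs (·L {Γ = Γ} {Δ} {A} {B} D) s = sound hs D (plug Γ Δ ·-split s)
    where
    ·-split : ⟪ [ A · B ] ⟫ ⊆ᵘ ⟪ A ∷ B ∷ [] ⟫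
    ·-split φ with ⟪[ A · B ]⟫⁻ φ
    ... | u , v , e , α , β = u , v , e , α , ⟪[ B ]⟫⁺ β
  sound hs (·R {Γ = Γ} {Δ} D₁ D₂) s with ⟪++⟫⁻ Γ Δ s
  ... | u , v , e , γ , δ = u , v , e , sound hs D₁ γ , sound hs D₂ δ
  sound hs (＼L {Γ = Γ} {Π} {Δ} {A} {B} D₁ D₂) s =
    sound hs D₂ (plug Γ Δ ＼-apply (subst (λ Θ → ⟪ Θ ⟫ _) (cong (Γ ++_) (sym (++-assoc Π _ Δ))) s))
    where
    ＼-apply : ⟪ Π ++ [ A ＼ B ] ⟫ ⊆ᵘ ⟪ [ B ] ⟫
    ＼-apply φ with ⟪++⟫⁻ Π _ φ
    ... | p , q , refl , π , f = ⟪[ B ]⟫⁺ (⟪[ A ＼ B ]⟫⁻ f p (sound hs D₁ π))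
  sound hs (／L {Γ = Γ} {Π} {Δ} {A} {B} D₁ D₂) s = sound hs D₂ (plug Γ Δ ／-apply s)
    where
    ／-apply : ⟪ (B ／ A) ∷ Π ⟫ ⊆ᵘ ⟪ [ B ] ⟫
    ／-apply (q , p , refl , f , π) = ⟪[ B ]⟫⁺ (f p (sound hs D₁ π))
  sound hs (＼R D) {w} s v α = sound hs D (v , w , refl , α , s)
  sound hs (／R {Π = Π} {A} D) {w} s v α = sound hs D (⟪++⟫⁺ Π [ A ] (w , v , refl , s , ⟪[ A ]⟫⁺ α))
  sound hs (∧L₁ {Γ = Γ} {Δ} {A} {B} D) s =
    sound hs D (plug Γ Δ (λ φ → ⟪[ A ]⟫⁺ (proj₁ (⟪[ A ∧ B ]⟫⁻ φ))) s)
  sound hs (∧L₂ {Γ = Γ} {Δ} {A} {B} D) s =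
    sound hs D (plug Γ Δ (λ φ → ⟪[ B ]⟫⁺ (proj₂ (⟪[ A ∧ B ]⟫⁻ φ))) s)
  sound hs (∧R D₁ D₂) s = sound hs D₁ s , sound hs D₂ s
  sound hs (∨L {Γ = Γ} {Δ} {A} {B} D₁ D₂) s
    with plug-⋃ Γ Δ {Ψ = λ i → [ if i then A else B ]} ∨-cases s
    where
    ∨-cases : ⟪ [ A ∨ B ] ⟫ ⊆ᵘ ⋃ Bool (λ i → ⟪ [ if i then A else B ] ⟫)
    ∨-cases (u , v , e , inj₁ α , ε≡v) = true  , u , v , e , α , ε≡v
    ∨-cases (u , v , e , inj₂ β , ε≡v) = false , u , v , e , β , ε≡v
  ... | true  , s′ = sound hs D₁ s′
  ... | false , s′ = sound hs D₂ s′
  sound hs (∨R₁ D) s = inj₁ (sound hs D s)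
  sound hs (∨R₂ D) s = inj₂ (sound hs D s)
  sound hs (cut {Γ = Γ} {Π} {Δ} {A} D₁ D₂) s =
    sound hs D₂ (plug Γ Δ (λ π → ⟪[ A ]⟫⁺ (sound hs D₁ π)) s)
  sound hs (⋆L {Γ = Γ} {Δ} {A} D) s
    with plug-⋃ Γ Δ {Ψ = λ n → replicate n A} (λ φ → ⋆-unfold (⟪[ A ⋆ ]⟫⁻ φ)) s
    where
    ⋆-unfold : ⟦ A ⋆ ⟧ ⊆ᵘ ⋃ ℕ (λ n → ⟪ replicate n A ⟫)
    ⋆-unfold (n , αⁿ) = n , ⟪replicate⟫ A n αⁿ
  ... | n , s′ = sound hs (D n) s′
  sound hs (⋆R {A = A} n Πs Ds) s = n , ⋆-fold n Πs (λ i → sound hs (Ds i)) s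
    where
    ⋆-fold : ∀ n (Πs : Vector (List (Fm true)) n) → (∀ i → Holds (Πs i , A)) →
             ⟪ concat (toList Πs) ⟫ ⊆ᵘ ⟦ A ⟧ ^ n
    ⋆-fold zero    Πs hs′ e = e
    ⋆-fold (suc n) Πs hs′ s with ⟪++⟫⁻ (Πs Fin.zero) _ s
    ... | u , v , e , π , πs =
      u , v , e , hs′ Fin.zero π , ⋆-fold n (λ i → Πs (Fin.suc i)) (λ i → hs′ (Fin.suc i)) πs

x y z w : ∀ {b} → Fm b
x = var 0
y = var 1
z = var 2
w = var 3

𝓗 : ∀ {b} → List (Seq b)
𝓗 = ([] ⇒ z) ∷ (x ∷ z ∷ y ∷ [] ⇒ z) ∷ (x ∷ z ∷ [] ⇒ w) ∷ (x ∷ w ∷ [] ⇒ w)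
  ∷ ([ z ∧ w ] ⇒ ⊥) ∷ ([] ⇒ y · x) ∷ []

goal : ∀ {b} → Seq b
goal = [] ⇒ ⊥

module Countermodel where
  ρ : ℕ → Pred ℤ 0ℓ
  ρ 0 = ｛ 1ℤ ｝
  ρ 1 = ｛ -1ℤ ｝
  ρ 2 = ｛ 0ℤ ｝
  ρ 3 n = Σ[ m ∈ ℕ ] +[1+ m ] ≡ n
  ρ _ = ∅

  open PowersetModel ℤ.+-0-isMonoid ρ

  𝓗-holds : ∀ {b} → All Holds (𝓗 {b})
  𝓗-holds = (λ e → e)
          ∷ (λ { (_ , _ , refl , refl , _ , _ , refl , refl , _ , _ , refl , refl , refl) → refl })
          ∷ (λ { (_ , _ , refl , refl , _ , _ , refl , refl , refl) → 0 , refl })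
          ∷ (λ { (_ , _ , refl , refl , _ , _ , refl , (m , refl) , refl) → suc (m + 0) , refl })
          ∷ (λ { (_ , _ , refl , (refl , (_ , ())) , refl) })
          ∷ (λ { refl → -1ℤ , 1ℤ , refl , refl , refl })
          ∷ []

  goal-underivable : ∀ {b} → ¬ Der b 𝓗 goal
  goal-underivable D = sound 𝓗-holds D refl

module SCLProperties {A : Set} (L : List A → Set) where
  open SCL L

  Full : Lg
  Full t = ∀ a c → L (a ++ t ++ c)

  cl∅⊆Full : cl ∅ ⊆ Full
  cl∅⊆Full t f a c = f a c (λ _ ())

  Full⊆cl∅ : Full ⊆ cl ∅
  Full⊆cl∅ t f a c _ = f a c

  ⊆-cl : ∀ {N} → N ⊆ cl N
  ⊆-cl t n a c r = r t n

  ⊗-cl : ∀ {N N′ u v} → N u → N′ v → cl (N ⊗ N′) (u ++ v)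
  ⊗-cl n n′ = ⊆-cl _ (_ , _ , refl , n , n′)

  Full-infix : ∀ p q {t} → Full t → Full (p ++ t ++ q)
  Full-infix p q {t} f a c = subst L reassoc (f (a ++ p) (q ++ c))
    where
    reassoc : (a ++ p) ++ t ++ q ++ c ≡ a ++ (p ++ t ++ q) ++ c
    reassoc = solve (++-monoid A)

  cl⊗-unit-elim : ∀ {N N′} p q → cl (N ⊗ N′) [] →
                  (∀ {v u} → N v → N′ u → Full (p ++ v ++ u ++ q)) → Full (p ++ q)
  cl⊗-unit-elim {N} {N′} p q unit h a c =
    subst L reassoc (unit (a ++ p) (q ++ c) inserted)
    where
    reassoc : (a ++ p) ++ q ++ c ≡ a ++ (p ++ q) ++ c
    reassoc = solve (++-monoid A)

    inserted : rt (N ⊗ N′) (a ++ p) (q ++ c)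
    inserted _ (v , u , refl , n , n′) = subst L reassoc′ (h n n′ a c)
      where
      reassoc′ : a ++ (p ++ v ++ u ++ q) ++ c ≡ (a ++ p) ++ (v ++ u) ++ q ++ c
      reassoc′ = solve (++-monoid A)

length-take++drop : ∀ {A : Set} {i j} (xs : List A) → i < j → j ≤ length xs →
                    length xs < length (take j xs ++ drop i xs)
length-take++drop {i = i} {j} xs i<j j≤ = begin-strict
  length xs                                   ≡⟨ m+[n∸m]≡n (<⇒≤ (<-≤-trans i<j j≤)) ⟨
  i + (length xs ∸ i)                         <⟨ +-monoˡ-< (length xs ∸ i) i<j ⟩
  j + (length xs ∸ i)                         ≡⟨ cong₂ _+_ (m≤n⇒m⊓n≡m j≤) (length-drop i xs) ⟨
  j ⊓ length xs + length (drop i xs)          ≡⟨ cong (_+ length (drop i xs)) (length-take j xs) ⟨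
  length (take j xs) + length (drop i xs)     ≡⟨ length-++ (take j xs) ⟨
  length (take j xs ++ drop i xs)             ∎
  where open ≤-Reasoning

module DFAProperties {k} (D : DFA k) where
  open DFA D

  run-++ : ∀ q u v → run q (u ++ v) ≡ run (run q u) v
  run-++ q []      v = refl
  run-++ q (a ∷ u) v = run-++ (δ q a) u v

  run-concat-++ : ∀ q ps rs t → run q (concat (ps ++ rs) ++ t) ≡ run (run q (concat ps)) (concat rs ++ t)
  run-concat-++ q ps rs t = begin
    run q (concat (ps ++ rs) ++ t)               ≡⟨ cong (λ u → run q (u ++ t)) (concat-++ ps rs) ⟨
    run q ((concat ps ++ concat rs) ++ t)        ≡⟨ cong (run q) (++-assoc (concat ps) (concat rs) t) ⟩
    run q (concat ps ++ concat rs ++ t)          ≡⟨ run-++ q (concat ps) (concat rs ++ t) ⟩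
    run (run q (concat ps)) (concat rs ++ t)     ∎
    where open ≡-Reasoning

  Lang-resp : ∀ a c {u u′} → run (run start a) u ≡ run (run start a) u′ →
              Lang (a ++ u ++ c) → Lang (a ++ u′ ++ c)
  Lang-resp a c {u} {u′} same = subst (λ q → accept q ≡ true) (begin
    run start (a ++ u ++ c)            ≡⟨ run-++ start a (u ++ c) ⟩
    run (run start a) (u ++ c)         ≡⟨ run-++ (run start a) u c ⟩
    run (run (run start a) u) c        ≡⟨ cong (λ q → run q c) same ⟩
    run (run (run start a) u′) c       ≡⟨ run-++ (run start a) u′ c ⟨
    run (run start a) (u′ ++ c)        ≡⟨ run-++ start a (u′ ++ c) ⟨
    run start (a ++ u′ ++ c)           ∎)
    where open ≡-Reasoning

  pumping : ∀ q (us : List (List (Fin k))) → states ≤ length us →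
            Σ[ us′ ∈ List (List (Fin k)) ]
              length us < length us′
              × (∀ {P : Pred (List (Fin k)) 0ℓ} → All P us → All P us′)
              × (∀ t → run q (concat us′ ++ t) ≡ run q (concat us ++ t))
  pumping q us long with pigeonhole (n<1+n states) (λ i → run q (concat (take (toℕ i) us)))
  ... | i , j , i<j , same =
    take (toℕ j) us ++ drop (toℕ i) us ,
    length-take++drop us i<j (≤-trans (m<1+n⇒m≤n (toℕ<n j)) long) ,
    (λ ps → ++⁺ (take⁺ (toℕ j) ps) (drop⁺ (toℕ i) ps)) ,
    λ t → begin
      run q (concat (take (toℕ j) us ++ drop (toℕ i) us) ++ t)
        ≡⟨ run-concat-++ q (take (toℕ j) us) (drop (toℕ i) us) t ⟩
      run (run q (concat (take (toℕ j) us))) (concat (drop (toℕ i) us) ++ t)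
        ≡⟨ cong (λ r → run r (concat (drop (toℕ i) us) ++ t)) same ⟨
      run (run q (concat (take (toℕ i) us))) (concat (drop (toℕ i) us) ++ t)
        ≡⟨ run-concat-++ q (take (toℕ i) us) (drop (toℕ i) us) t ⟨
      run q (concat (take (toℕ i) us ++ drop (toℕ i) us) ++ t)
        ≡⟨ cong (λ vs → run q (concat vs ++ t)) (take++drop≡id (toℕ i) us) ⟩
      run q (concat us ++ t)
        ∎
    where open ≡-Reasoning

-- The factors from y are listed from the middle of xⁿyⁿ outwards, the order in which they arise.
rconcat : ∀ {A : Set} → List (List A) → List A
rconcat []       = []
rconcat (v ∷ vs) = rconcat vs ++ v

module RegularModel {b} (𝓜 : RegModel) (holds : ∀ h → h ∈ 𝓗 {b} → TrueIn 𝓜 h) where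
  open RegModel 𝓜 using (k; dfa; α; closed)
  open DFA dfa using (states; start; run; Lang)
  open DFAProperties dfa using (Lang-resp; pumping)
  open SCL Lang
  open SCLProperties Lang

  X Y Z W : Lg
  X = α 0
  Y = α 1
  Z = α 2
  W = α 3

  ε∈Z : Z []
  ε∈Z = holds _ (here refl)

  xzy∈Z : ∀ {u t v} → X u → Z t → Y v → Z (u ++ t ++ v)
  xzy∈Z xu zt yv = holds _ (there (here refl)) _ (⊗-cl xu (_ , _ , refl , zt , yv))

  xz∈W : ∀ {u t} → X u → Z t → W (u ++ t)
  xz∈W xu zt = holds _ (there (there (here refl))) _ (⊗-cl xu zt)

  xw∈W : ∀ {u t} → X u → W t → W (u ++ t)
  xw∈W xu wt = holds _ (there (there (there (here refl)))) _ (⊗-cl xu wt)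

  z∧w-Full : ∀ {t} → Z t → W t → Full t
  z∧w-Full zt wt = cl∅⊆Full _ (holds _ (there (there (there (there (here refl))))) _ (⊆-cl _ (zt , wt)))

  ε∈cl-yx : cl (Y ⊗ X) []
  ε∈cl-yx = holds _ (there (there (there (there (there (here refl))))))

  xⁿyⁿ∈Z : ∀ {us vs} → length us ≡ length vs → All X us → All Y vs → Z (concat us ++ rconcat vs)
  xⁿyⁿ∈Z {[]}     {[]}     _  []         []         = ε∈Z
  xⁿyⁿ∈Z {u ∷ us} {v ∷ vs} eq (xu ∷ xus) (yv ∷ yvs) =
    subst Z reassoc (xzy∈Z xu (xⁿyⁿ∈Z (suc-injective eq) xus yvs) yv)
    where
    reassoc : u ++ (concat us ++ rconcat vs) ++ v ≡ (u ++ concat us) ++ rconcat vs ++ v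
    reassoc = solve (++-monoid (Fin k))

  xᵐyⁿ∈W : ∀ {us vs} → length vs < length us → All X us → All Y vs → W (concat us ++ rconcat vs)
  xᵐyⁿ∈W {u ∷ us} {vs} (s≤s vs≤us) (xu ∷ xus) yvs =
    subst W (sym (++-assoc u (concat us) (rconcat vs))) W-tail
    where
    W-tail : W (u ++ concat us ++ rconcat vs)
    W-tail with m≤n⇒m<n∨m≡n vs≤us
    ... | inj₁ vs<us = xw∈W xu (xᵐyⁿ∈W vs<us xus yvs)
    ... | inj₂ vs≡us = xz∈W xu (xⁿyⁿ∈Z (sym vs≡us) xus yvs)

  xⁿyⁿ∈W : ∀ {us vs} → states ≤ length us → length vs ≤ length us → All X us → All Y vs →
           W (concat us ++ rconcat vs)
  xⁿyⁿ∈W {us} {vs} long vs≤us xus yvs = proj₂ (closed 3) _ λ a c ctx →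
    let us′ , longer , pumped , same = pumping (run start a) us long
    in Lang-resp a c (same (rconcat vs)) (ctx _ (xᵐyⁿ∈W (≤-<-trans vs≤us longer) (pumped xus) yvs))

  yⁿxⁿ-insert : ∀ n {q} →
                (∀ {vs us} → length vs ≡ n → length us ≡ n → All Y vs → All X us →
                   Full (rconcat vs ++ concat us ++ q)) →
                Full q
  yⁿxⁿ-insert zero    h = h {[]} {[]} refl refl [] []
  yⁿxⁿ-insert (suc n) {q} h = yⁿxⁿ-insert n λ {vs} {us} |vs| |us| yvs xus →
    cl⊗-unit-elim (rconcat vs) (concat us ++ q) ε∈cl-yx λ {v} {u} yv xu →
      subst Full (reassoc vs us v u) (h (cong suc |vs|) (cong suc |us|) (yv ∷ yvs) (xu ∷ xus))
    where
    reassoc : ∀ vs us v u →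
              (rconcat vs ++ v) ++ (u ++ concat us) ++ q ≡ rconcat vs ++ v ++ u ++ concat us ++ q
    reassoc vs us v u = solve (++-monoid (Fin k))

  ε-Full : Full []
  ε-Full = yⁿxⁿ-insert states λ {vs} {us} |vs| |us| yvs xus →
           yⁿxⁿ-insert states λ {vs′} {us′} |vs′| |us′| yvs′ xus′ →
    subst Full (cong (rconcat vs′ ++_) (++-assoc (concat us′) (rconcat vs) _))
      (Full-infix (rconcat vs′) (concat us ++ [])
        (z∧w-Full (xⁿyⁿ∈Z (trans |us′| (sym |vs|)) xus′ yvs)
                  (xⁿyⁿ∈W (≤-reflexive (sym |us′|)) (≤-reflexive (trans |vs| (sym |us′|))) xus′ yvs)))

not-strongly-complete : ∀ b → NotStronglyComplete b
not-strongly-complete b =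
  𝓗 , goal , (λ 𝓜 holds → SCLProperties.Full⊆cl∅ (RegModel.Lang 𝓜) [] (RegularModel.ε-Full 𝓜 holds)) ,
  Countermodel.goal-underivable

theorem5 : NotStronglyComplete true × NotStronglyComplete false
theorem5 = not-strongly-complete true , not-strongly-complete false
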